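{- Let $\alpha=a_p,a_{p-1},\ldots,a_1$ and $\beta=b_1,b_2,\ldots,b_n$ be non-empty finite sequences of positive integers, and let $G=\alpha\circledcirc\beta=a_p\ldots a_1\circledcirc b_1\ldots b_n$ be a mis\`ere \textsc{cricket pitch} position which is reduced, i.e. $a_p$ and $b_n$ are even. Index both sides from the roller outward, so that $\alpha$ is regarded as the sequence $(a_1,a_2,\ldots,a_p)$ and $\beta$ as $(b_1,\ldots,b_n)$. For a sequence $\gamma=(c_1,\ldots,c_s)$ of positive integers let $m(\gamma)=\max\{i: c_i \text{ is odd and } c_i\le c_j \text{ for all } j<i\}$ and $M(\gamma)=c_{m(\gamma)}$ if this set is non-empty, and $m(\gamma)=M(\gamma)=\infty$ otherwise. Then: \begin{enumerate} \item if $M(\alpha)<M(\beta)$ then $o(G)=\mathcal{L}$; \item if $M(\alpha)>M(\beta)$ then $o(G)=\mathcal{R}$; \item if $M(\alpha)=M(\beta)<\infty$ then $o(G)=\mathcal{N}$; \item if $M(\alpha)=M(\beta)=\infty$ then $o(G)=\mathcal{P}$. \end{enumerate}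
   Context: \textsc{cricket pitch}: a position is a finite row of bumps (non-negative integers) with one roller placed between two bumps or at one end; it is written $a_m\ldots a_1\circledcirc b_1\ldots b_n$, where $\circledcirc$ is the roller, so $a_1$ and $b_1$ are the bumps adjacent to the roller. Left moves the roller to the left over any positive number of consecutive bumps; Right moves it to the right over any positive number of consecutive bumps. Each bump rolled over is reduced by $1$. A bump of value $0$ is no longer a bump and can no longer be rolled over. Mis\`ere play: the player who cannot move on their turn wins. Outcome classes: $\mathcal{L}$ (Left wins whoever moves first), $\mathcal{R}$ (Right wins whoever moves first), $\mathcal{N}$ (the player moving first wins), $\mathcal{P}$ (the player moving second wins). -}

module Defs where

open import Data.Nat using (ℕ; zero; suc; _<_; _≤ᵇ_)
open import Data.Bool using (Bool; true; false; _∧_; if_then_else_)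
open import Data.List using (List; []; _∷_)
open import Data.Maybe using (Maybe; just; nothing)
open import Data.Product using (Σ; _×_; _,_)
open import Data.Empty using (⊥)
open import Data.Unit using (⊤)
open import Relation.Binary.Construct.Closure.Transitive using (TransClosure)

-- A position  a_m … a_1 ⊚ b_1 … b_n  is the pair (a_1 ∷ … ∷ a_m , b_1 ∷ … ∷ b_n):
-- both sides are listed from the roller outward.  Bumps of value 0 stay in
-- the row (they are not bumps any more and block the roller).

Pos : Set
Pos = List ℕ × List ℕ

data StepL : Pos → Pos → Set where
  stepL : ∀ {x as bs} → StepL (suc x ∷ as , bs) (as , x ∷ bs)

data StepR : Pos → Pos → Set where
  stepR : ∀ {x as bs} → StepR (as , suc x ∷ bs) (x ∷ as , bs)

-- A Left (Right) move: roll over a positive number of consecutive bumps,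
-- i.e. one or more single steps in the same direction.
LeftMove : Pos → Pos → Set
LeftMove = TransClosure StepL

RightMove : Pos → Pos → Set
RightMove = TransClosure StepR

-- Misère play: a player who cannot move on their turn wins.
--   LFirst  G : Left, moving first in G, wins.
--   LSecond G : Right is to move in G and Left wins.
--   RFirst / RSecond symmetric.

mutual
  data LFirst (G : Pos) : Set where
    lNoMove : (∀ G' → LeftMove G G' → ⊥) → LFirst G
    lGood   : ∀ G' → LeftMove G G' → LSecond G' → LFirst G

  data LSecond (G : Pos) : Set where
    lAll : (Σ Pos λ G' → RightMove G G') →
           (∀ G' → RightMove G G' → LFirst G') → LSecond G

mutual
  data RFirst (G : Pos) : Set where
    rNoMove : (∀ G' → RightMove G G' → ⊥) → RFirst G
    rGood   : ∀ G' → RightMove G G' → RSecond G' → RFirst G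

  data RSecond (G : Pos) : Set where
    rAll : (Σ Pos λ G' → LeftMove G G') →
           (∀ G' → LeftMove G G' → RFirst G') → RSecond G

data Outcome : Set where
  𝓛 𝓡 𝓝 𝓟 : Outcome

HasOutcome : Pos → Outcome → Set
HasOutcome G 𝓛 = LFirst G × LSecond G
HasOutcome G 𝓡 = RFirst G × RSecond G
HasOutcome G 𝓝 = LFirst G × RFirst G
HasOutcome G 𝓟 = LSecond G × RSecond G

odd : ℕ → Bool
odd zero = false
odd (suc zero) = true
odd (suc (suc n)) = odd n

-- c ≤ every earlier entry; the earlier minimum is nothing when there is none.
≤min : ℕ → Maybe ℕ → Bool
≤min c nothing  = true
≤min c (just m) = c ≤ᵇ m

newMin : ℕ → Maybe ℕ → Maybe ℕ
newMin c nothing = just c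
newMin c (just m) = if c ≤ᵇ m then just c else just m

-- scan left to right, keeping the minimum of earlier entries and the value at
-- the largest qualifying index seen so far.
Mgo : Maybe ℕ → Maybe ℕ → List ℕ → Maybe ℕ
Mgo mn best [] = best
Mgo mn best (c ∷ cs) =
  Mgo (newMin c mn) (if odd c ∧ ≤min c mn then just c else best) cs

M : List ℕ → Maybe ℕ
M γ = Mgo nothing nothing γ

-- strict order on ℕ ∪ {∞}, with ∞ = nothing.
_<∞_ : Maybe ℕ → Maybe ℕ → Set
just a  <∞ just b  = a < b
just a  <∞ nothing = ⊤
nothing <∞ _       = ⊥

-- Read a side from the roller outward up to its first 0.  Its value is allOdd if these
-- bumps are all odd, and otherwise the paper's M of the part before the last even bump
-- (∞ when undefined); for a reduced side this is M itself.  Two relations on the values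
-- of Left's and Right's sides, WinsFirst and WinsSecond, together with the misère rule
-- that a player without a move wins, form an invariant: from a WinsFirst position Left
-- can move to a WinsSecond one, and every Right move from a WinsSecond position leads to
-- a WinsFirst one.  Left rolls over the bump realising M (and over one more if that bump
-- is 1), or over its first bump when M is undefined, leaving Right a side of value ∞ or
-- allOdd.  A Right move is analysed through the smallest bump it rolls over: Left's
-- candidate survives the roll, or a new one below it appears.  Induction on the total
-- height of the bumps turns the invariant into strategies, Right's follow by mirroring,
-- and comparing the two values of a reduced position gives the four cases.

{-# OPTIONS --safe #-}
module Submission where

open import Defs
open import Data.Bool using (true; false; not; _∧_; if_then_else_)
open import Data.Bool.Properties using (not-involutive; T-≡)
open import Data.Empty using (⊥; ⊥-elim)
open import Data.List using (List; []; _∷_; _++_; _∷ʳ_; map; reverse; _ʳ++_)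
open import Data.List.Properties using (++-assoc; map-++; ++-ʳ++; ʳ++-defn)
open import Data.List.Relation.Unary.All as All using (All; []; _∷_)
open import Data.List.Relation.Unary.All.Properties using (++⁻ˡ; ++⁻ʳ; ∷ʳ⁺; ∷ʳ⁻; map⁺)
open import Data.Maybe using (Maybe; just; nothing)
open import Data.Nat using (ℕ; zero; suc; pred; _+_; _*_; _≤_; _<_; _⊓_; _≤ᵇ_; z≤n; s≤s)
open import Data.Nat.Divisibility using (_∣_; divides)
open import Data.Nat.Induction using (<-wellFounded)
open import Data.Nat.ListAction using (sum)
open import Data.Nat.Properties
open import Algebra.Properties.CommutativeSemigroup +-commutativeSemigroup using (xy∙z≈y∙xz)
open import Data.Product using (∃; ∃₂; _×_; _,_; proj₁; proj₂; swap)
open import Data.Sum using (_⊎_; inj₁; inj₂; map₂)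
open import Data.Unit using (⊤; tt)
open import Function using (Equivalence; _∘_)
open import Induction.WellFounded using (Acc; acc)
open import Relation.Binary.Construct.Closure.Transitive using (TransClosure; [_]; _∷_)
open import Relation.Binary.PropositionalEquality
  using (_≡_; _≢_; refl; sym; trans; cong; subst; subst₂; module ≡-Reasoning)
open import Relation.Nullary using (Dec; yes; no)
open import Relation.Nullary.Reflects using (ofʸ; ofⁿ)

odd-suc : ∀ n → odd (suc n) ≡ not (odd n)
odd-suc zero          = refl
odd-suc (suc zero)    = refl
odd-suc (suc (suc n)) = odd-suc n

odd-pred : ∀ n → 0 < n → odd (pred n) ≡ not (odd n)
odd-pred (suc n) _ = sym (trans (cong not (odd-suc n)) (not-involutive (odd n)))

odd-pred⇒even : ∀ n → 0 < n → odd (pred n) ≡ true → odd n ≡ false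
odd-pred⇒even n n>0 odd-pn =
  trans (sym (not-involutive (odd n))) (cong not (trans (sym (odd-pred n n>0)) odd-pn))

even⇒odd-pred : ∀ n → 0 < n → odd n ≡ false → odd (pred n) ≡ true
even⇒odd-pred n n>0 even-n = trans (odd-pred n n>0) (cong not even-n)

odd⇒even-pred : ∀ n → 0 < n → odd n ≡ true → odd (pred n) ≡ false
odd⇒even-pred n n>0 odd-n = trans (odd-pred n n>0) (cong not odd-n)

odd⇒1≤ : ∀ {n} → odd n ≡ true → 1 ≤ n
odd⇒1≤ {suc n} _ = s≤s z≤n

odd⇒≡1⊎3≤ : ∀ n → odd n ≡ true → n ≡ 1 ⊎ 3 ≤ n
odd⇒≡1⊎3≤ 1                 _ = inj₁ refl
odd⇒≡1⊎3≤ (suc (suc (suc n))) _ = inj₂ (s≤s (s≤s (s≤s z≤n)))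

odd≤even⇒< : ∀ {h a} → odd h ≡ true → odd a ≡ false → h ≤ a → h < a
odd≤even⇒< odd-h even-a h≤a = ≤∧≢⇒< h≤a λ { refl → true≢false (trans (sym odd-h) even-a) }
  where
  true≢false : true ≢ false
  true≢false ()

2∣⇒even : ∀ {n} → 2 ∣ n → odd n ≡ false
2∣⇒even (divides q refl) = even-double q
  where
  even-double : ∀ q → odd (q * 2) ≡ false
  even-double zero    = refl
  even-double (suc q) = even-double q

≤⇒≤ᵇ≡true : ∀ {m n} → m ≤ n → (m ≤ᵇ n) ≡ true
≤⇒≤ᵇ≡true m≤n = Equivalence.to T-≡ (≤⇒≤ᵇ m≤n)

-- The value of a side

-- scan m γ is the value of γ when the bumps before γ are all ≥ m: fin c for the last odd c
-- before the last even bump (of γ, up to its first 0) with c ≤ m and c ≤ all earlier bumps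
-- of γ, ∞ if there is no such c, and allOdd if there is no even bump.
data Scan : Set where
  allOdd ∞ : Scan
  fin      : ℕ → Scan

extend : ℕ → ℕ → Scan → Scan
extend m c allOdd  = if odd c then allOdd else ∞
extend m c ∞       = if odd c ∧ (c ≤ᵇ m) then fin c else ∞
extend m c (fin h) = fin h

scan : ℕ → List ℕ → Scan
scan m []          = allOdd
scan m (zero ∷ γ)  = allOdd
scan m (suc c ∷ γ) = extend m (suc c) (scan (m ⊓ suc c) γ)

-- The first bump c has no predecessors, so the bound c does not exclude it.
side : List ℕ → Scan
side []      = allOdd
side (c ∷ γ) = scan c (c ∷ γ)

extend-fin⁻ : ∀ {m c h} s → extend m c s ≡ fin h →
              s ≡ fin h ⊎ (s ≡ ∞ × h ≡ c × odd c ≡ true × c ≤ m)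
extend-fin⁻ (fin h) refl = inj₁ refl
extend-fin⁻ {m} {c} ∞ eq with odd c | c ≤ᵇ m | ≤ᵇ-reflects-≤ c m | eq
... | true  | true  | ofʸ c≤m | refl = inj₂ (refl , refl , refl , c≤m)
... | true  | false | _       | ()
... | false | _     | _       | ()
extend-fin⁻ {c = c} allOdd eq with odd c | eq
... | true  | ()
... | false | ()

extend-allOdd⁻ : ∀ {m c} s → extend m c s ≡ allOdd → s ≡ allOdd × odd c ≡ true
extend-allOdd⁻ {c = c} allOdd eq with odd c | eq
... | true  | _  = refl , refl
... | false | ()
extend-allOdd⁻ {m} {c} ∞ eq with odd c ∧ (c ≤ᵇ m) | eq
... | true  | ()
... | false | ()

extend-∞⁻ : ∀ {m c} s → extend m c s ≡ ∞ →
            (s ≡ ∞ × (odd c ≡ true → c ≤ m → ⊥)) ⊎ (s ≡ allOdd × odd c ≡ false)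
extend-∞⁻ {c = c} allOdd eq with odd c | eq
... | true  | ()
... | false | _  = inj₂ (refl , refl)
extend-∞⁻ {m} {c} ∞ eq with odd c | c ≤ᵇ m | ≤ᵇ-reflects-≤ c m | eq
... | true  | true  | _       | ()
... | true  | false | ofⁿ c≰m | _ = inj₁ (refl , λ _ → c≰m)
... | false | _     | _       | _ = inj₁ (refl , λ ())

scan-fin⁻ : ∀ {m h} γ → scan m γ ≡ fin h → h ≤ m × odd h ≡ true
scan-fin⁻ {m} (suc c ∷ γ) eq with extend-fin⁻ (scan (m ⊓ suc c) γ) eq
... | inj₁ eq′ with scan-fin⁻ γ eq′
...   | h≤m⊓c , odd-h = ≤-trans h≤m⊓c (m⊓n≤m m (suc c)) , odd-h
scan-fin⁻ (suc c ∷ γ) eq | inj₂ (_ , refl , odd-c , c≤m) = c≤m , odd-c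

scan-fin-head : ∀ {m h c} γ → scan m (c ∷ γ) ≡ fin h → h ≤ c
scan-fin-head {m} {c = suc c} γ eq with extend-fin⁻ (scan (m ⊓ suc c) γ) eq
... | inj₁ eq′              = m≤n⊓o⇒m≤o m (suc c) (proj₁ (scan-fin⁻ γ eq′))
... | inj₂ (_ , refl , _)   = ≤-refl

scan-fin-stable : ∀ {m m′ h} γ → scan m γ ≡ fin h → h ≤ m′ → scan m′ γ ≡ fin h
scan-fin-stable {m} {m′} (suc c ∷ γ) eq h≤m′ with extend-fin⁻ (scan (m ⊓ suc c) γ) eq
... | inj₁ eq′
  rewrite scan-fin-stable γ eq′ (⊓-glb h≤m′ (m≤n⊓o⇒m≤o m (suc c) (proj₁ (scan-fin⁻ γ eq′)))) = refl
... | inj₂ (eq∞ , refl , odd-c , c≤m)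
  rewrite m≥n⇒m⊓n≡n h≤m′ | m≥n⇒m⊓n≡n c≤m | eq∞ | odd-c | ≤⇒≤ᵇ≡true h≤m′ = refl

scan-allOdd-stable : ∀ {m m′} γ → scan m γ ≡ allOdd → scan m′ γ ≡ allOdd
scan-allOdd-stable []          _  = refl
scan-allOdd-stable (zero ∷ γ)  _  = refl
scan-allOdd-stable {m} {m′} (suc c ∷ γ) eq with extend-allOdd⁻ (scan (m ⊓ suc c) γ) eq
... | eq′ , odd-c rewrite scan-allOdd-stable {m′ = m′ ⊓ suc c} γ eq′ | odd-c = refl

scan-allOdd⇒side : ∀ {m} γ → scan m γ ≡ allOdd → side γ ≡ allOdd
scan-allOdd⇒side []      _  = refl
scan-allOdd⇒side (c ∷ γ) eq = scan-allOdd-stable (c ∷ γ) eq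

side-allOdd⇒scan : ∀ {m} γ → side γ ≡ allOdd → scan m γ ≡ allOdd
side-allOdd⇒scan []      _  = refl
side-allOdd⇒scan (c ∷ γ) eq = scan-allOdd-stable (c ∷ γ) eq

scan-fin⇒side : ∀ {m h} γ → scan m γ ≡ fin h → side γ ≡ fin h
scan-fin⇒side (c ∷ γ) eq = scan-fin-stable (c ∷ γ) eq (scan-fin-head γ eq)

side-fin⇒scan : ∀ {m h} γ → side γ ≡ fin h → h ≤ m → scan m γ ≡ fin h
side-fin⇒scan (c ∷ γ) eq = scan-fin-stable (c ∷ γ) eq

side-fin⇒odd : ∀ {h} γ → side γ ≡ fin h → odd h ≡ true
side-fin⇒odd (c ∷ γ) eq = proj₂ (scan-fin⁻ (c ∷ γ) eq)

scan-∞⇒side≢allOdd : ∀ {m} γ → scan m γ ≡ ∞ → side γ ≢ allOdd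
scan-∞⇒side≢allOdd γ eq eq′ with () ← trans (sym eq) (side-allOdd⇒scan γ eq′)

side-even-head : ∀ {e} γ → 0 < e → odd e ≡ false → side (e ∷ γ) ≢ allOdd
side-even-head {suc e} γ _ even-e eq
  with () ← trans (sym (proj₂ (extend-allOdd⁻ (scan (suc e ⊓ suc e) γ) eq))) even-e

scan-++-≢allOdd : ∀ {m b} q γ → All (0 <_) q → scan b γ ≢ allOdd → scan m (q ++ γ) ≢ allOdd
scan-++-≢allOdd []          γ _         γ≢ eq = γ≢ (scan-allOdd-stable γ eq)
scan-++-≢allOdd {m} (suc c ∷ q) γ (_ ∷ q>0) γ≢ eq =
  scan-++-≢allOdd q γ q>0 γ≢ (proj₁ (extend-allOdd⁻ (scan (m ⊓ suc c) (q ++ γ)) eq))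

side-++-≢allOdd : ∀ q γ → All (0 <_) q → side γ ≢ allOdd → side (q ++ γ) ≢ allOdd
side-++-≢allOdd q γ q>0 γ≢ eq =
  scan-++-≢allOdd {0} {0} q γ q>0 (λ eq′ → γ≢ (scan-allOdd⇒side γ eq′)) (side-allOdd⇒scan (q ++ γ) eq)

scan-++-fin : ∀ {m b h} q γ → All (0 <_) q → All (h ≤_) q → h ≤ m → scan b γ ≡ fin h →
              scan m (q ++ γ) ≡ fin h
scan-++-fin []          γ _         _           h≤m eq = scan-fin-stable γ eq h≤m
scan-++-fin (suc c ∷ q) γ (_ ∷ q>0) (h≤c ∷ q≥h) h≤m eq
  rewrite scan-++-fin q γ q>0 q≥h (⊓-glb h≤m h≤c) eq = refl

side-++-fin : ∀ {b h} q γ → All (0 <_) q → All (h ≤_) q → scan b γ ≡ fin h → side (q ++ γ) ≡ fin h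
side-++-fin q γ q>0 q≥h eq = scan-fin⇒side (q ++ γ) (scan-++-fin q γ q>0 q≥h ≤-refl eq)

scan-odd-head : ∀ {c} γ → odd c ≡ true → side γ ≢ allOdd → ∃ λ h → h ≤ c × scan c (c ∷ γ) ≡ fin h
scan-odd-head {suc c} γ odd-c γ≢ rewrite ⊓-idem (suc c) with scan (suc c) γ in eq
... | fin h  = h , proj₁ (scan-fin⁻ γ eq) , refl
... | ∞      rewrite odd-c | ≤⇒≤ᵇ≡true (≤-refl {suc c}) = suc c , ≤-refl , refl
... | allOdd = ⊥-elim (γ≢ (scan-allOdd⇒side γ eq))

side-++-odd : ∀ {c} q γ → All (0 <_) q → All (c ≤_) q → odd c ≡ true → side γ ≢ allOdd →
              ∃ λ h → h ≤ c × side (q ++ c ∷ γ) ≡ fin h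
side-++-odd q γ q>0 q≥c odd-c γ≢ with scan-odd-head γ odd-c γ≢
... | h , h≤c , eq = h , h≤c , side-++-fin q (_ ∷ γ) q>0 (All.map (≤-trans h≤c) q≥c) eq

scan-++-no-fin : ∀ {m} q γ → All (λ c → odd c ≡ true → m < c) q →
                 (∀ h → scan m γ ≢ fin h) → ∀ h → scan m (q ++ γ) ≢ fin h
scan-++-no-fin []          γ _               γ-no-fin = γ-no-fin
scan-++-no-fin (zero ∷ q)  γ _               _        h ()
scan-++-no-fin {m} (suc c ∷ q) γ (big-c ∷ q-big) γ-no-fin h eq
  with extend-fin⁻ (scan (m ⊓ suc c) (q ++ γ)) eq
... | inj₁ eq′ =
  scan-++-no-fin q γ (All.map (λ big odd → ≤-<-trans m⊓c≤m (big odd)) q-big) γ-no-fin′ h eq′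
  where
  m⊓c≤m : m ⊓ suc c ≤ m
  m⊓c≤m = m⊓n≤m m (suc c)
  γ-no-fin′ : ∀ h′ → scan (m ⊓ suc c) γ ≢ fin h′
  γ-no-fin′ h′ eq″ = γ-no-fin h′ (scan-fin-stable γ eq″ (≤-trans (proj₁ (scan-fin⁻ γ eq″)) m⊓c≤m))
... | inj₂ (_ , _ , odd-c , c≤m) = <⇒≱ (big-c odd-c) c≤m

scan-fin-split : ∀ {m h} α → scan m α ≡ fin h →
                 ∃₂ λ p r → α ≡ p ++ h ∷ r × All (h ≤_) p × scan h r ≡ ∞
scan-fin-split {m} (suc c ∷ α) eq with extend-fin⁻ (scan (m ⊓ suc c) α) eq
... | inj₁ eq′ with scan-fin-split α eq′
...   | p , r , refl , p≥h , eq∞ =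
        suc c ∷ p , r , refl , m≤n⊓o⇒m≤o m (suc c) (proj₁ (scan-fin⁻ (p ++ _ ∷ r) eq′)) ∷ p≥h , eq∞
scan-fin-split {m} (suc c ∷ α) eq | inj₂ (eq∞ , refl , _ , c≤m) rewrite m≥n⇒m⊓n≡n c≤m =
  [] , α , refl , [] , eq∞

side-odd-∷ : ∀ {c} γ → odd c ≡ true → side γ ≡ allOdd → side (c ∷ γ) ≡ allOdd
side-odd-∷ {suc c} γ odd-c eq rewrite side-allOdd⇒scan {suc c ⊓ suc c} γ eq | odd-c = refl

side-even-∷ : ∀ {e} γ → 0 < e → odd e ≡ false → (∀ h → scan e γ ≢ fin h) → side (e ∷ γ) ≡ ∞
side-even-∷ {suc e} γ _ even-e no-fin rewrite ⊓-idem (suc e) with scan (suc e) γ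
... | fin h  = ⊥-elim (no-fin h refl)
... | ∞      rewrite even-e = refl
... | allOdd rewrite even-e = refl

side-∞-head : ∀ {c} γ → side (c ∷ γ) ≡ ∞ → odd c ≡ false
side-∞-head {suc c} γ eq with odd (suc c) | extend-∞⁻ (scan (suc c ⊓ suc c) γ) eq
... | false | _                 = refl
... | true  | inj₁ (_ , ¬found) = ⊥-elim (¬found refl ≤-refl)
... | true  | inj₂ (_ , ())

All-ʳ++ : ∀ {Q : ℕ → Set} {xs ys} → All Q xs → All Q ys → All Q (xs ʳ++ ys)
All-ʳ++ []         qys = qys
All-ʳ++ (qx ∷ qxs) qys = All-ʳ++ qxs (qx ∷ qys)

All-rolled : ∀ {Q : ℕ → Set} {P} → All (λ x → Q (pred x)) P → All Q (reverse (map pred P))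
All-rolled qs = All-ʳ++ (map⁺ qs) []

roll-++ : ∀ xs ys {γ} → map pred (xs ++ ys) ʳ++ γ ≡ map pred ys ʳ++ map pred xs ʳ++ γ
roll-++ xs ys = trans (cong (_ʳ++ _) (map-++ pred xs ys)) (++-ʳ++ (map pred xs))

side-roll-fin : ∀ {hy} P γ → All (hy <_) P → side γ ≡ fin hy → side (map pred P ʳ++ γ) ≡ fin hy
side-roll-fin P γ P>hy eq rewrite ʳ++-defn (map pred P) {γ} =
  side-++-fin (reverse (map pred P)) γ
    (All-rolled (All.map (λ hy<x → ≤-trans (odd⇒1≤ (side-fin⇒odd γ eq)) (<⇒≤pred hy<x)) P>hy))
    (All-rolled (All.map <⇒≤pred P>hy))
    (side-fin⇒scan γ eq ≤-refl)

side-roll-≢allOdd : ∀ P γ → All (λ x → 0 < pred x) P → side γ ≢ allOdd →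
                    side (map pred P ʳ++ γ) ≢ allOdd
side-roll-≢allOdd P γ P>1 γ≢ rewrite ʳ++-defn (map pred P) {γ} =
  side-++-≢allOdd (reverse (map pred P)) γ (All-rolled P>1) γ≢

-- The winning criteria

WinsFirst : Scan → Scan → Set
WinsFirst allOdd  _       = ⊥
WinsFirst ∞       allOdd  = ⊤
WinsFirst ∞       _       = ⊥
WinsFirst (fin a) (fin b) = a ≤ b
WinsFirst (fin a) _       = ⊤

WinsSecond : Scan → Scan → Set
WinsSecond _       allOdd  = ⊤
WinsSecond ∞       ∞       = ⊤
WinsSecond (fin a) ∞       = ⊤
WinsSecond (fin a) (fin b) = a < b
WinsSecond _       _       = ⊥

data Blocked : List ℕ → Set where
  blocked-[] : Blocked []
  blocked-0  : ∀ {γ} → Blocked (0 ∷ γ)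

data Movable : List ℕ → Set where
  movable : ∀ {c γ} → Movable (suc c ∷ γ)

LeftWinsFirst : Pos → Set
LeftWinsFirst (α , β) = Blocked α ⊎ WinsFirst (side α) (side β)

LeftWinsSecond : Pos → Set
LeftWinsSecond (α , β) = Movable β × WinsSecond (side α) (side β)

allOdd? : ∀ s → Dec (s ≡ allOdd)
allOdd? allOdd  = yes refl
allOdd? ∞       = no λ ()
allOdd? (fin _) = no λ ()

WinsFirst-allOdd : ∀ {x} → x ≢ allOdd → WinsFirst x allOdd
WinsFirst-allOdd {allOdd} x≢ = x≢ refl
WinsFirst-allOdd {∞}      _  = tt
WinsFirst-allOdd {fin _}  _  = tt

WinsFirst-∞⁻ : ∀ {y} → WinsFirst ∞ y → y ≡ allOdd
WinsFirst-∞⁻ {allOdd} _ = refl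

WinsFirst-below-∞ : ∀ {μ n} γ → scan μ γ ≡ ∞ → n ≤ μ → WinsFirst (fin n) (side γ)
WinsFirst-below-∞ {μ} {n} γ eq n≤μ with side γ in eq-γ
... | allOdd = tt
... | ∞      = tt
... | fin h  = ≤-trans n≤μ (<⇒≤ (≰⇒> λ h≤μ → ∞≢fin (trans (sym eq) (side-fin⇒scan γ eq-γ h≤μ))))
  where
  ∞≢fin : ∞ ≢ fin h
  ∞≢fin ()

WinsSecond-∞ : ∀ {x} → x ≢ allOdd → WinsSecond x ∞
WinsSecond-∞ {allOdd} x≢ = x≢ refl
WinsSecond-∞ {∞}      _  = tt
WinsSecond-∞ {fin _}  _  = tt

WinsSecond-≢allOdd : ∀ {x y} → y ≢ allOdd → WinsSecond x y → x ≢ allOdd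
WinsSecond-≢allOdd {y = allOdd} y≢ _ = ⊥-elim (y≢ refl)
WinsSecond-≢allOdd {∞}     {∞}     _ _ ()
WinsSecond-≢allOdd {fin _} {∞}     _ _ ()
WinsSecond-≢allOdd {fin _} {fin _} _ _ ()

WinsSecond-fin⁻ : ∀ {x h} → WinsSecond x (fin h) → ∃ λ hy → x ≡ fin hy × hy < h
WinsSecond-fin⁻ {fin hy} hy<h = hy , refl , hy<h

-- Left's winning move

leftMove : ∀ p {c r β} → All (0 <_) p → 0 < c →
           LeftMove (p ++ c ∷ r , β) (r , pred c ∷ map pred p ʳ++ β)
leftMove []          {suc c} _         _   = [ stepL ]
leftMove (suc a ∷ p)         (_ ∷ p>0) c>0 = stepL ∷ leftMove p p>0 c>0

odd⇒movable : ∀ {c γ} → odd c ≡ true → Movable (c ∷ γ)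
odd⇒movable {suc c} _ = movable

move-from-∞ : ∀ α β → side α ≡ ∞ → side β ≡ allOdd →
              ∃ λ G′ → LeftMove (α , β) G′ × LeftWinsSecond G′
move-from-∞ (suc a ∷ α) β eq-α eq-β =
  (α , a ∷ β) , leftMove [] [] (s≤s z≤n) , odd⇒movable odd-a , winsSecond
  where
  odd-a : odd a ≡ true
  odd-a = even⇒odd-pred (suc a) (s≤s z≤n) (side-∞-head α eq-α)
  winsSecond : WinsSecond (side α) (side (a ∷ β))
  winsSecond = subst (WinsSecond (side α)) (sym (side-odd-∷ {a} β odd-a eq-β)) tt

move-over-candidate : ∀ p r β {h} → All (h ≤_) p → 3 ≤ h → odd h ≡ true → scan h r ≡ ∞ →
                      (∀ {b} → side β ≡ fin b → h ≤ b) →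
                      ∃ λ G′ → LeftMove (p ++ h ∷ r , β) G′ × LeftWinsSecond G′
move-over-candidate p r β {h@(suc (suc (suc _)))} p≥h (s≤s (s≤s (s≤s _))) odd-h eq-r β≥h =
  (r , pred h ∷ map pred p ʳ++ β) , leftMove p (All.map (≤-trans (s≤s z≤n)) p≥h) (s≤s z≤n) ,
  movable , winsSecond
  where
  β-no-fin : ∀ h′ → scan (pred h) β ≢ fin h′
  β-no-fin h′ eq = <⇒≱ (s≤s (proj₁ (scan-fin⁻ β eq))) (β≥h (scan-fin⇒side β eq))
  odd⇒above : ∀ {x} → h ≤ x → odd (pred x) ≡ true → pred h < pred x
  odd⇒above {x} h≤x odd-px =
    <⇒≤pred (odd≤even⇒< odd-h (odd-pred⇒even x (≤-trans (s≤s z≤n) h≤x) odd-px) h≤x)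
  rolled-no-fin : ∀ h′ → scan (pred h) (map pred p ʳ++ β) ≢ fin h′
  rolled-no-fin rewrite ʳ++-defn (map pred p) {β} =
    scan-++-no-fin (reverse (map pred p)) β (All-rolled (All.map odd⇒above p≥h)) β-no-fin
  winsSecond : WinsSecond (side r) (side (pred h ∷ map pred p ʳ++ β))
  winsSecond
    rewrite side-even-∷ (map pred p ʳ++ β) (s≤s z≤n) (odd⇒even-pred h (s≤s z≤n) odd-h) rolled-no-fin =
    WinsSecond-∞ (scan-∞⇒side≢allOdd r eq-r)

-- Stopping after the 1 would leave Right blocked, so Left also rolls over the next bump.
move-over-1 : ∀ p r β → All (1 ≤_) p → scan 1 r ≡ ∞ →
              ∃ λ G′ → LeftMove (p ++ 1 ∷ r , β) G′ × LeftWinsSecond G′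
move-over-1 p (suc zero ∷ r) β p>0 eq with extend-∞⁻ (scan 1 r) eq
... | inj₁ (_ , ¬found) = ⊥-elim (¬found refl ≤-refl)
... | inj₂ (_ , ())
move-over-1 p (suc (suc c) ∷ r) β p>0 eq =
  (r , suc c ∷ 0 ∷ map pred p ʳ++ β) , move , movable , winsSecond
  where
  move : LeftMove (p ++ 1 ∷ suc (suc c) ∷ r , β) (r , suc c ∷ 0 ∷ map pred p ʳ++ β)
  move = subst₂ (λ α γ → LeftMove (α , β) (r , suc c ∷ γ))
           (++-assoc p (1 ∷ []) _) (roll-++ p (1 ∷ []))
           (leftMove (p ∷ʳ 1) (∷ʳ⁺ p>0 (s≤s z≤n)) (s≤s z≤n))
  winsSecond : WinsSecond (side r) (if odd (suc c) then allOdd else ∞)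
  winsSecond with odd (suc c) in odd-c | extend-∞⁻ (scan 1 r) eq
  ... | true  | _                 = tt
  ... | false | inj₁ (eq∞ , _)    = WinsSecond-∞ (scan-∞⇒side≢allOdd r eq∞)
  ... | false | inj₂ (_ , even-c) with () ← trans (sym odd-c) (trans (odd-suc c) (cong not even-c))

winning-leftMove : ∀ α β → WinsFirst (side α) (side β) →
                   ∃ λ G′ → LeftMove (α , β) G′ × LeftWinsSecond G′
winning-leftMove α β wins with side α in eq-α
... | allOdd = ⊥-elim wins
... | ∞     = move-from-∞ α β eq-α (WinsFirst-∞⁻ wins)
... | fin h with scan-fin-split α (side-fin⇒scan α eq-α ≤-refl) | odd⇒≡1⊎3≤ h (side-fin⇒odd α eq-α)
...   | p , r , refl , p≥h , eq-r | inj₁ refl = move-over-1 p r β p≥h eq-r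
...   | p , r , refl , p≥h , eq-r | inj₂ 3≤h  =
        move-over-candidate p r β p≥h 3≤h (side-fin⇒odd (p ++ h ∷ r) eq-α) eq-r
          (λ eq-β → subst (WinsFirst (fin h)) eq-β wins)

-- Right's moves

data RightRoll (α : List ℕ) : List ℕ → Pos → Set where
  rollOver : ∀ p {c} r → All (0 <_) p → 0 < c →
             RightRoll α (p ++ c ∷ r) (pred c ∷ map pred p ʳ++ α , r)

rightMove⇒roll : ∀ {α β G′} → RightMove (α , β) G′ → RightRoll α β G′
rightMove⇒roll [ stepR ]   = rollOver [] _ [] (s≤s z≤n)
rightMove⇒roll (stepR ∷ m) with rightMove⇒roll m
... | rollOver p r p>0 c>0 = rollOver (suc _ ∷ p) r (s≤s z≤n ∷ p>0) c>0

one∈⊎2≤ : ∀ p → All (0 <_) p → (∃₂ λ u w → p ≡ u ++ 1 ∷ w) ⊎ All (2 ≤_) p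
one∈⊎2≤ []                _         = inj₂ []
one∈⊎2≤ (zero ∷ p)        (() ∷ _)
one∈⊎2≤ (suc zero ∷ p)    _         = inj₁ ([] , p , refl)
one∈⊎2≤ (suc (suc x) ∷ p) (_ ∷ p>0) with one∈⊎2≤ p p>0
... | inj₁ (u , w , refl) = inj₁ (suc (suc x) ∷ u , w , refl)
... | inj₂ p≥2            = inj₂ (s≤s (s≤s z≤n) ∷ p≥2)

min-split : ∀ p c → ∃₂ λ u μ → ∃ λ w → p ∷ʳ c ≡ u ++ μ ∷ w × All (μ ≤_) (p ∷ʳ c)
min-split []      c = [] , c , [] , refl , ≤-refl ∷ []
min-split (x ∷ p) c with min-split p c
... | u , μ , w , eq , p≥μ with x ≤? μ
...   | yes x≤μ = [] , x , p ∷ʳ c , refl , ≤-refl ∷ All.map (≤-trans x≤μ) p≥μ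
...   | no  x≰μ = x ∷ u , μ , w , cong (x ∷_) eq , <⇒≤ (≰⇒> x≰μ) ∷ p≥μ

WinsSecond-against-1 : ∀ α u γ → All (0 <_) u → side γ ≢ allOdd →
                       WinsSecond (side α) (side (u ++ 1 ∷ γ)) → ⊥
WinsSecond-against-1 α u γ u>0 γ≢ wins with side-++-odd u γ u>0 u>0 refl γ≢
... | h , h≤1 , eq with WinsSecond-fin⁻ (subst (WinsSecond (side α)) eq wins)
...   | hy , eq-α , hy<h = <⇒≱ (<-≤-trans (s≤s (odd⇒1≤ (side-fin⇒odd α eq-α))) hy<h) h≤1

roll-keeps-fin : ∀ α P {h} → All (h ≤_) P → WinsSecond (side α) (fin h) →
                 ∃ λ hy → hy < h × side (map pred P ʳ++ α) ≡ fin hy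
roll-keeps-fin α P P≥h wins with WinsSecond-fin⁻ wins
... | hy , eq-α , hy<h = hy , hy<h , side-roll-fin P α (All.map (<-≤-trans hy<h) P≥h) eq-α

rolled-blocked⊎≢allOdd : ∀ α p {c} r → All (0 <_) p → 0 < c →
                         WinsSecond (side α) (side (p ++ c ∷ r)) →
                         Blocked (pred c ∷ map pred p ʳ++ α) ⊎
                         side (pred c ∷ map pred p ʳ++ α) ≢ allOdd
rolled-blocked⊎≢allOdd α p {c} r p>0 c>0 wins with odd c in odd-c
... | true with odd⇒≡1⊎3≤ c odd-c
...   | inj₁ refl = inj₁ blocked-0
...   | inj₂ 3≤c  =
        inj₂ (side-even-head _ (≤-trans (s≤s z≤n) (pred-mono-≤ 3≤c)) (odd⇒even-pred c c>0 odd-c))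
rolled-blocked⊎≢allOdd α p {c} r p>0 c>0 wins | false with one∈⊎2≤ p p>0
... | inj₁ (u , w , refl) =
  ⊥-elim (WinsSecond-against-1 α u (w ++ c ∷ r) (++⁻ˡ u p>0)
            (side-++-≢allOdd w (c ∷ r) (All.tail (++⁻ʳ u p>0)) (side-even-head r c>0 odd-c))
            (subst (λ β → WinsSecond (side α) (side β)) (++-assoc u (1 ∷ w) (c ∷ r)) wins))
... | inj₂ p≥2 =
  inj₂ (side-++-≢allOdd (pred c ∷ []) (map pred p ʳ++ α) (odd⇒1≤ (even⇒odd-pred c c>0 odd-c) ∷ [])
          (side-roll-≢allOdd p α (All.map pred-mono-≤ p≥2) α≢))
  where
  α≢ : side α ≢ allOdd
  α≢ = WinsSecond-≢allOdd (side-++-≢allOdd p (c ∷ r) p>0 (side-even-head r c>0 odd-c)) wins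

side-roll-even-min : ∀ α u {μ} w → All (μ ≤_) (u ++ μ ∷ w) → 0 < μ → odd μ ≡ false →
                     side α ≢ allOdd → ∃ λ h → h ≤ pred μ × side (map pred (u ++ μ ∷ w) ʳ++ α) ≡ fin h
side-roll-even-min α u {μ} w P≥μ μ>0 even-μ α≢
  rewrite roll-++ u (μ ∷ w) {α} | ʳ++-defn (map pred w) {pred μ ∷ map pred u ʳ++ α} =
  side-++-odd (reverse (map pred w)) (map pred u ʳ++ α)
    (All-rolled (All.map above-1 w≥μ)) (All-rolled (All.map pred-mono-≤ w≥μ)) odd-pμ
    (side-roll-≢allOdd u α (All.map above-1 (++⁻ˡ u P≥μ)) α≢)
  where
  odd-pμ : odd (pred μ) ≡ true
  odd-pμ = even⇒odd-pred μ μ>0 even-μ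
  w≥μ : All (μ ≤_) w
  w≥μ = All.tail (++⁻ʳ u P≥μ)
  above-1 : ∀ {x} → μ ≤ x → 0 < pred x
  above-1 μ≤x = ≤-trans (odd⇒1≤ odd-pμ) (pred-mono-≤ μ≤x)

-- μ is a smallest bump of P.  If r has a candidate h ≤ μ, or μ is odd, Right's candidate is
-- at most μ and Left's smaller one survives the roll; otherwise the odd bump pred μ gives
-- Left a candidate below μ.  Either way it lies below every candidate of r.
rolled-WinsFirst : ∀ α P r → All (0 <_) P → side r ≢ allOdd → WinsSecond (side α) (side (P ++ r)) →
                   ∀ u {μ} w → P ≡ u ++ μ ∷ w → All (μ ≤_) P →
                   WinsFirst (side (map pred P ʳ++ α)) (side r)
rolled-WinsFirst α P r P>0 r≢ wins u {μ} w refl P≥μ with scan μ r in eq-r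
... | allOdd = ⊥-elim (r≢ (scan-allOdd⇒side r eq-r))
... | fin h with scan-fin⁻ r eq-r
...   | h≤μ , _ with roll-keeps-fin α P (All.map (≤-trans h≤μ) P≥μ)
                     (subst (WinsSecond (side α))
                       (side-++-fin P r P>0 (All.map (≤-trans h≤μ) P≥μ) eq-r) wins)
...     | hy , hy<h , eq-α′ rewrite eq-α′ | scan-fin⇒side r eq-r = <⇒≤ hy<h
rolled-WinsFirst α P r P>0 r≢ wins u {μ} w refl P≥μ | ∞ with odd μ in odd-μ
... | true with side-++-odd u (w ++ r) (++⁻ˡ u P>0) (++⁻ˡ u P≥μ) odd-μ
                  (side-++-≢allOdd w r (All.tail (++⁻ʳ u P>0)) r≢)
...   | h , h≤μ , eq with roll-keeps-fin α P (All.map (≤-trans h≤μ) P≥μ)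
                          (subst (WinsSecond (side α)) (trans (cong side (++-assoc u (μ ∷ w) r)) eq) wins)
...     | hy , hy<h , eq-α′ rewrite eq-α′ = WinsFirst-below-∞ r eq-r (≤-trans (<⇒≤ hy<h) h≤μ)
rolled-WinsFirst α P r P>0 r≢ wins u {μ} w refl P≥μ | ∞ | false
  with side-roll-even-min α u w P≥μ (All.head (++⁻ʳ u P>0)) odd-μ
         (WinsSecond-≢allOdd (side-++-≢allOdd P r P>0 r≢) wins)
... | h , h≤pμ , eq-α′ rewrite eq-α′ = WinsFirst-below-∞ r eq-r (≤-trans h≤pμ pred[n]≤n)

after-rightRoll : ∀ {α β G′} → WinsSecond (side α) (side β) → RightRoll α β G′ → LeftWinsFirst G′
after-rightRoll {α} wins (rollOver p {c} r p>0 c>0) with allOdd? (side r)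
... | yes eq-r =
  map₂ (λ α′≢ → subst (WinsFirst _) (sym eq-r) (WinsFirst-allOdd α′≢))
       (rolled-blocked⊎≢allOdd α p r p>0 c>0 wins)
... | no r≢ with min-split p c
...   | u , μ , w , eq , P≥μ =
  inj₂ (subst (λ γ → WinsFirst (side γ) (side r)) (roll-++ p (c ∷ []))
          (rolled-WinsFirst α (p ∷ʳ c) r (∷ʳ⁺ p>0 c>0) r≢
            (subst (λ β → WinsSecond (side α) (side β)) (sym (++-assoc p (c ∷ []) r)) wins) u w eq P≥μ))

-- Strategies

size : Pos → ℕ
size (α , β) = sum α + sum β

stepL-shrinks : ∀ {G G′} → StepL G G′ → size G′ < size G
stepL-shrinks {suc x ∷ as , bs} stepL = s≤s (≤-reflexive (sym (xy∙z≈y∙xz x (sum as) (sum bs))))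

stepR-shrinks : ∀ {G G′} → StepR G G′ → size G′ < size G
stepR-shrinks {as , suc x ∷ bs} stepR =
  ≤-<-trans (≤-reflexive (xy∙z≈y∙xz x (sum as) (sum bs))) (+-monoʳ-< (sum as) ≤-refl)

move-shrinks : ∀ {R : Pos → Pos → Set} → (∀ {G G′} → R G G′ → size G′ < size G) →
               ∀ {G G′} → TransClosure R G G′ → size G′ < size G
move-shrinks shrinks [ step ]       = shrinks step
move-shrinks shrinks (step ∷ steps) = <-trans (move-shrinks shrinks steps) (shrinks step)

blocked⇒no-move : ∀ {α β G′} → Blocked α → LeftMove (α , β) G′ → ⊥
blocked⇒no-move blocked-[] [ () ]
blocked⇒no-move blocked-[] (() ∷ _)
blocked⇒no-move blocked-0  [ () ]
blocked⇒no-move blocked-0  (() ∷ _)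

movable⇒rightMove : ∀ {α β} → Movable β → ∃ λ G′ → RightMove (α , β) G′
movable⇒rightMove movable = _ , [ stepR ]

left-strategies : ∀ G → Acc _<_ (size G) →
                  (LeftWinsFirst G → LFirst G) × (LeftWinsSecond G → LSecond G)
left-strategies (α , β) (acc rec) = first , second
  where
  first : LeftWinsFirst (α , β) → LFirst (α , β)
  first (inj₁ blocked) = lNoMove λ _ m → blocked⇒no-move blocked m
  first (inj₂ wins) with winning-leftMove α β wins
  ... | G′ , m , wins′ =
    lGood G′ m (proj₂ (left-strategies G′ (rec (move-shrinks stepL-shrinks m))) wins′)
  second : LeftWinsSecond (α , β) → LSecond (α , β)
  second (mv , wins) = lAll (movable⇒rightMove mv) λ G′ m →
    proj₁ (left-strategies G′ (rec (move-shrinks stepR-shrinks m)))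
          (after-rightRoll wins (rightMove⇒roll m))

LeftWinsFirst⇒LFirst : ∀ G → LeftWinsFirst G → LFirst G
LeftWinsFirst⇒LFirst G = proj₁ (left-strategies G (<-wellFounded (size G)))

LeftWinsSecond⇒LSecond : ∀ G → LeftWinsSecond G → LSecond G
LeftWinsSecond⇒LSecond G = proj₂ (left-strategies G (<-wellFounded (size G)))

swap-rightMove : ∀ {G G′} → RightMove G G′ → LeftMove (swap G) (swap G′)
swap-rightMove [ stepR ]   = [ stepL ]
swap-rightMove (stepR ∷ m) = stepL ∷ swap-rightMove m

swap-leftMove : ∀ {G G′} → LeftMove G G′ → RightMove (swap G) (swap G′)
swap-leftMove [ stepL ]   = [ stepR ]
swap-leftMove (stepL ∷ m) = stepR ∷ swap-leftMove m

mutual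
  mirror-first : ∀ G → LFirst (swap G) → RFirst G
  mirror-first G (lNoMove no-move) = rNoMove λ G′ m → no-move (swap G′) (swap-rightMove m)
  mirror-first G (lGood G′ m wins) = rGood (swap G′) (swap-leftMove m) (mirror-second (swap G′) wins)

  mirror-second : ∀ G → LSecond (swap G) → RSecond G
  mirror-second G (lAll (G′ , m) wins) =
    rAll (swap G′ , swap-rightMove m) λ G″ m′ → mirror-first G″ (wins (swap G″) (swap-leftMove m′))

swap-LeftWinsFirst⇒RFirst : ∀ G → LeftWinsFirst (swap G) → RFirst G
swap-LeftWinsFirst⇒RFirst G = mirror-first G ∘ LeftWinsFirst⇒LFirst (swap G)

swap-LeftWinsSecond⇒RSecond : ∀ G → LeftWinsSecond (swap G) → RSecond G
swap-LeftWinsSecond⇒RSecond G = mirror-second G ∘ LeftWinsSecond⇒LSecond (swap G)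

-- Reduced positions

candidate : Maybe ℕ → Scan → Maybe ℕ
candidate _ (fin h) = just h
candidate d _       = d

newMin-just : ∀ c m → newMin c (just m) ≡ just (m ⊓ c)
newMin-just c m with c ≤ᵇ m | ≤ᵇ-reflects-≤ c m
... | true  | ofʸ c≤m = cong just (sym (m≥n⇒m⊓n≡n c≤m))
... | false | ofⁿ c≰m = cong just (sym (m≤n⇒m⊓n≡m (<⇒≤ (≰⇒> c≰m))))

candidate-extend : ∀ {m c} d s → s ≢ allOdd →
                   candidate d (extend m c s) ≡ candidate (if odd c ∧ (c ≤ᵇ m) then just c else d) s
candidate-extend d allOdd s≢ = ⊥-elim (s≢ refl)
candidate-extend {m} {c} d ∞ _ with odd c ∧ (c ≤ᵇ m)
... | true  = refl
... | false = refl
candidate-extend d (fin h) _ = refl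

reduced-≢allOdd : ∀ γ {e} → All (0 <_) (γ ∷ʳ e) → odd e ≡ false → side (γ ∷ʳ e) ≢ allOdd
reduced-≢allOdd γ {e} γe>0 even-e with ∷ʳ⁻ γe>0
... | γ>0 , e>0 = side-++-≢allOdd γ (e ∷ []) γ>0 (side-even-head [] e>0 even-e)

Mgo-scan : ∀ {m} d γ {e} → All (0 <_) (γ ∷ʳ e) → odd e ≡ false →
           Mgo (just m) d (γ ∷ʳ e) ≡ candidate d (scan m (γ ∷ʳ e))
Mgo-scan d []          {zero}  (() ∷ [])  _
Mgo-scan d []          {suc e} _          even-e rewrite even-e = refl
Mgo-scan d (zero ∷ γ)          (() ∷ _)   _
Mgo-scan {m} d (suc c ∷ γ) {e} (_ ∷ γe>0) even-e = begin
  Mgo (newMin (suc c) (just m)) d′ (γ ∷ʳ e)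
    ≡⟨ cong (λ mn → Mgo mn d′ (γ ∷ʳ e)) (newMin-just (suc c) m) ⟩
  Mgo (just (m ⊓ suc c)) d′ (γ ∷ʳ e)        ≡⟨ Mgo-scan d′ γ γe>0 even-e ⟩
  candidate d′ (scan (m ⊓ suc c) (γ ∷ʳ e))  ≡⟨ sym (candidate-extend d _ tail≢) ⟩
  candidate d (scan m (suc c ∷ γ ∷ʳ e))     ∎
  where
  open ≡-Reasoning
  d′ : Maybe ℕ
  d′ = if odd (suc c) ∧ (suc c ≤ᵇ m) then just (suc c) else d
  tail≢ : scan (m ⊓ suc c) (γ ∷ʳ e) ≢ allOdd
  tail≢ eq = reduced-≢allOdd γ γe>0 even-e (scan-allOdd⇒side (γ ∷ʳ e) eq)

M-anchor : ∀ c γ → M (c ∷ γ) ≡ Mgo (just c) nothing (c ∷ γ)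
M-anchor c γ rewrite newMin-just c c | ⊓-idem c | ≤⇒≤ᵇ≡true (≤-refl {c}) = refl

M-reduced : ∀ γ {e} → All (0 <_) (γ ∷ʳ e) → odd e ≡ false →
            M (γ ∷ʳ e) ≡ candidate nothing (side (γ ∷ʳ e))
M-reduced []      γe>0 even-e = trans (M-anchor _ []) (Mgo-scan nothing [] γe>0 even-e)
M-reduced (c ∷ γ) γe>0 even-e =
  trans (M-anchor c (γ ∷ʳ _)) (Mgo-scan nothing (c ∷ γ) γe>0 even-e)

reduced-movable : ∀ γ {e} → All (0 <_) (γ ∷ʳ e) → Movable (γ ∷ʳ e)
reduced-movable []          {zero}  (() ∷ [])
reduced-movable []          {suc e} _ = movable
reduced-movable (suc c ∷ γ)         _ = movable
reduced-movable (zero ∷ γ)  (() ∷ _)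

<∞-wins : ∀ {x y} → x ≢ allOdd → y ≢ allOdd → candidate nothing x <∞ candidate nothing y →
          WinsFirst x y × WinsSecond x y
<∞-wins {allOdd}          x≢ _  _  = ⊥-elim (x≢ refl)
<∞-wins {fin a} {allOdd}  _  y≢ _  = ⊥-elim (y≢ refl)
<∞-wins {fin a} {∞}       _  _  _  = tt , tt
<∞-wins {fin a} {fin b}   _  _  lt = <⇒≤ lt , lt

≡just-wins : ∀ {x y k} → candidate nothing x ≡ just k → candidate nothing y ≡ just k →
             WinsFirst x y × WinsFirst y x
≡just-wins {fin a} {fin b} refl refl = ≤-refl , ≤-refl

≡nothing-wins : ∀ {x y} → x ≢ allOdd → y ≢ allOdd → candidate nothing x ≡ nothing →
                candidate nothing y ≡ nothing → WinsSecond x y × WinsSecond y x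
≡nothing-wins {allOdd}     x≢ _  _ _ = ⊥-elim (x≢ refl)
≡nothing-wins {∞} {allOdd} _  y≢ _ _ = ⊥-elim (y≢ refl)
≡nothing-wins {∞} {∞}      _  _  _ _ = tt , tt

theorem6 : (α β : List ℕ) →
    All (0 <_) α → All (0 <_) β →
    (∃ λ α₀ → ∃ λ a → α ≡ α₀ ∷ʳ a × 2 ∣ a) →
    (∃ λ β₀ → ∃ λ b → β ≡ β₀ ∷ʳ b × 2 ∣ b) →
    (M α <∞ M β → HasOutcome (α , β) 𝓛)
    × (M β <∞ M α → HasOutcome (α , β) 𝓡)
    × (∀ k → M α ≡ just k → M β ≡ just k → HasOutcome (α , β) 𝓝)
    × (M α ≡ nothing → M β ≡ nothing → HasOutcome (α , β) 𝓟)
theorem6 .(α₀ ∷ʳ a) .(β₀ ∷ʳ b) α>0 β>0 (α₀ , a , refl , 2∣a) (β₀ , b , refl , 2∣b)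
  rewrite M-reduced α₀ α>0 (2∣⇒even 2∣a) | M-reduced β₀ β>0 (2∣⇒even 2∣b) =
  (λ lt → let wf , ws = <∞-wins α≢ β≢ lt in
          LeftWinsFirst⇒LFirst G (inj₂ wf) , LeftWinsSecond⇒LSecond G (β-movable , ws)) ,
  (λ lt → let wf , ws = <∞-wins β≢ α≢ lt in
          swap-LeftWinsFirst⇒RFirst G (inj₂ wf) , swap-LeftWinsSecond⇒RSecond G (α-movable , ws)) ,
  (λ _ eqα eqβ → let wf , wf′ = ≡just-wins eqα eqβ in
          LeftWinsFirst⇒LFirst G (inj₂ wf) , swap-LeftWinsFirst⇒RFirst G (inj₂ wf′)) ,
  (λ eqα eqβ → let ws , ws′ = ≡nothing-wins α≢ β≢ eqα eqβ in
          LeftWinsSecond⇒LSecond G (β-movable , ws) , swap-LeftWinsSecond⇒RSecond G (α-movable , ws′))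
  where
  G : Pos
  G = α₀ ∷ʳ a , β₀ ∷ʳ b
  α≢ : side (α₀ ∷ʳ a) ≢ allOdd
  α≢ = reduced-≢allOdd α₀ α>0 (2∣⇒even 2∣a)
  β≢ : side (β₀ ∷ʳ b) ≢ allOdd
  β≢ = reduced-≢allOdd β₀ β>0 (2∣⇒even 2∣b)
  α-movable : Movable (α₀ ∷ʳ a)
  α-movable = reduced-movable α₀ α>0
  β-movable : Movable (β₀ ∷ʳ b)
  β-movable = reduced-movable β₀ β>0
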